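{- For each feasible basis structure $(L,T,U,\bar e)$ of the transformed problem and its corresponding basic feasible flow $x$, it holds that $x_e\notin\mathbb{N}_{\geq0}$ for all edges $e$ of the cycle $C(\bar e)$.
   Context: Budget-constrained minimum cost flow problem: given a directed multigraph $G=(V,E)$, capacities $u_e\in\mathbb{N}_{\geq 0}$, costs $c_e\in\mathbb{Z}$, usage fees $b_e\in\mathbb{N}_{\geq0}$ and a budget $B\in\mathbb{N}_{\geq0}$, find $x$ with $0\le x\le u$, flow conservation at every node, and $b(x):=\sum_e b_ex_e\le B$, minimizing $\sum_e c_ex_e$. The transformed problem is the same instance with budget $B':=B+\tfrac12$. A basis structure is a tuple $(L,T,U,\bar e)$ with $\bar e\in E$, $L,T,U$ a partition of $E\setminus\{\bar e\}$, $T$ the edge set of a spanning tree (orientations ignored), such that the unique undirected cycle $C(\bar e)$ in $T\cup\{\bar e\}$ has $\sum_{C^+(\bar e)}b-\sum_{C^-(\bar e)}b\neq0$ ($C^\pm(\bar e)$: cycle edges oriented the same/opposite way as $\bar e$). Its basic solution for the transformed problem is the unique $x$ satisfying flow conservation, $x_e=0$ on $L$, $x_e=u_e$ on $U$, and $b(x)=B'$; the basis structure is feasible if $0\le x\le u$, and $x$ is then its basic feasible flow. -}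

module Defs where

open import Data.Nat using (ℕ; zero; suc)
open import Data.Fin using (Fin; zero; suc)
open import Data.Integer as ℤ using (ℤ; +_)
open import Data.Rational as ℚ using (ℚ; ½; 0ℚ)
open import Data.List using (List; []; _∷_; map)
open import Data.List.Relation.Unary.Unique.Propositional using (Unique)
open import Data.List.Membership.Propositional using (_∈_)
open import Data.Product using (_×_; Σ; _,_; proj₁)
open import Relation.Binary.PropositionalEquality using (_≡_; _≢_)

Σℚ : ∀ {m} → (Fin m → ℚ) → ℚ
Σℚ {zero}  f = 0ℚ
Σℚ {suc m} f = f zero ℚ.+ Σℚ (λ i → f (suc i))

ℕ→ℚ : ℕ → ℚ
ℕ→ℚ k = (+ k) ℚ./ 1

record Graph (n m : ℕ) : Set where
  field
    tail : Fin m → Fin n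
    head : Fin m → Fin n
open Graph public

module _ {n m : ℕ} (G : Graph n m) where

  -- Undirected walks from v to w using only edges satisfying S
  -- (fwd: edge traversed along its orientation, bwd: against it).
  data Walk (S : Fin m → Set) : Fin n → Fin n → Set where
    []  : ∀ {v} → Walk S v v
    fwd : ∀ {w} (e : Fin m) → S e → Walk S (head G e) w → Walk S (tail G e) w
    bwd : ∀ {w} (e : Fin m) → S e → Walk S (tail G e) w → Walk S (head G e) w

  edges : ∀ {S v w} → Walk S v w → List (Fin m)
  edges []          = []
  edges (fwd e _ p) = e ∷ edges p
  edges (bwd e _ p) = e ∷ edges p

  verts : ∀ {S v w} → Walk S v w → List (Fin n)
  verts {v = v} []  = v ∷ []
  verts {v = v} (fwd e _ p) = v ∷ verts p
  verts {v = v} (bwd e _ p) = v ∷ verts p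

  initVerts : ∀ {S v w} → Walk S v w → List (Fin n)
  initVerts []          = []
  initVerts {v = v} (fwd e _ p) = v ∷ initVerts p
  initVerts {v = v} (bwd e _ p) = v ∷ initVerts p

  nonEmpty : ∀ {S v w} → Walk S v w → Set
  nonEmpty p = edges p ≢ []

  IsPath : ∀ {S v w} → Walk S v w → Set
  IsPath p = Unique (verts p)

  IsCycle : ∀ {S v} → Walk S v v → Set
  IsCycle p = nonEmpty p × Unique (edges p) × Unique (initVerts p)

  IsSpanningTree : (Fin m → Set) → Set
  IsSpanningTree S =
    (∀ v w → Walk S v w) × (∀ v (p : Walk S v v) → IsCycle p → Data.Empty.⊥)
    where import Data.Empty

  signedSum : ∀ {S v w} → (Fin m → ℕ) → Walk S v w → ℤ
  signedSum b []          = + 0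
  signedSum b (fwd e _ p) = + b e ℤ.+ signedSum b p
  signedSum b (bwd e _ p) = ℤ.- (+ b e) ℤ.+ signedSum b p

-- A budget-constrained min cost flow instance.
record Instance (n m : ℕ) : Set where
  field
    graph : Graph n m
    u     : Fin m → ℕ
    c     : Fin m → ℤ
    b     : Fin m → ℕ   -- usage fees
    B     : ℕ           -- budget
open Instance public

-- Classes of the partition E = L ⊎ T ⊎ U ⊎ {ē}
data Kind : Set where
  kL kT kU kBar : Kind

-- Basis structure (L,T,U,ē) given by a classification of all edges.
record BasisStructure {n m : ℕ} (I : Instance n m) : Set where
  field
    cls  : Fin m → Kind
    ebar : Fin m
    cls-ebar : cls ebar ≡ kBar
    cls-bar-unique : ∀ e → cls e ≡ kBar → e ≡ ebar
    tree : IsSpanningTree (graph I) (λ e → cls e ≡ kT)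
  InT : Fin m → Set
  InT e = cls e ≡ kT
  -- the tree path from head ē back to tail ē; together with ē it forms C(ē)
  -- (it exists and is unique since T is a spanning tree)
  CyclePath : Set
  CyclePath = Σ (Walk (graph I) InT (head (graph I) ebar) (tail (graph I) ebar))
                (IsPath (graph I))
  -- Σ_{C⁺(ē)} b − Σ_{C⁻(ē)} b for the cycle ē followed by path p
  cycleFeeDiff : CyclePath → ℤ
  cycleFeeDiff (p , _) = + b I ebar ℤ.+ signedSum (graph I) (b I) p
  field
    nondeg : ∀ (P : CyclePath) → cycleFeeDiff P ≢ + 0
open BasisStructure public

-- x is the basic solution of the transformed problem (budget B + ½)
-- associated with the basis structure BS.
IsBasicSolution : ∀ {n m} (I : Instance n m) → BasisStructure I → (Fin m → ℚ) → Set
IsBasicSolution {n} {m} I BS x =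
    (∀ (v : Fin n) →
       Σℚ (λ e → inflow e v) ≡ Σℚ (λ e → outflow e v))
  × (∀ e → cls BS e ≡ kL → x e ≡ 0ℚ)
  × (∀ e → cls BS e ≡ kU → x e ≡ ℕ→ℚ (u I e))
  × (Σℚ (λ e → ℕ→ℚ (b I e) ℚ.* x e) ≡ ℕ→ℚ (B I) ℚ.+ ½)
  where
    open import Data.Fin using (_≟_)
    open import Relation.Nullary using (yes; no)
    inflow : Fin m → Fin n → ℚ
    inflow e v with head (graph I) e ≟ v
    ... | yes _ = x e
    ... | no  _ = 0ℚ
    outflow : Fin m → Fin n → ℚ
    outflow e v with tail (graph I) e ≟ v
    ... | yes _ = x e
    ... | no  _ = 0ℚ

IsFeasibleFlow : ∀ {n m} (I : Instance n m) → (Fin m → ℚ) → Set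
IsFeasibleFlow I x = ∀ e → (0ℚ ℚ.≤ x e) × (x e ℚ.≤ ℕ→ℚ (u I e))

OnCycle : ∀ {n m} {I : Instance n m} (BS : BasisStructure I) → CyclePath BS → Fin m → Set
OnCycle {I = I} BS (p , _) e = (e ≡ ebar BS) Data.Sum.⊎ (e ∈ edges (graph I) p)
  where import Data.Sum

module Submission where

-- The idea is that integrality propagates along tree cuts.
--  * Cut lemma: for a conserved flow and a two-colouring σ of the nodes,
--    Σ_g x_g (⟦σ(head g)⟧ − ⟦σ(tail g)⟧) = 0.  So if every edge crossing the
--    cut except g₀ carries integral flow, the flow on g₀ is integral too.
--  * Tree cuts: deleting a tree edge f splits the nodes in two; the side of
--    v is the parity of f on any tree walk from a fixed root.  This is well
--    defined because a closed walk using f an odd number of times contains a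
--    cycle (split it at repeated vertices and edges).  Among tree edges only
--    f crosses this cut, and ē crosses it when f lies on C(ē).
--  * Edges in L and U carry the integers 0 and u_e.  If x_e ∈ ℕ for some e
--    on C(ē), the cut at e makes x_ē integral, and then the cut at each tree
--    edge g makes x_g integral.  So b(x) is an integer, contradicting
--    b(x) = B + ½.

open import Defs
open import Data.Nat as ℕ using (ℕ; zero; suc; _<_; _≤_; s≤s; z≤n)
import Data.Nat.Properties as ℕP
open import Data.Bool using (Bool; true; false; _xor_)
open import Data.Bool.Properties using (xor-assoc; xor-comm; xor-same; xor-identityʳ)
open import Data.Fin using (Fin; zero; suc; _≟_; punchIn)
open import Data.Fin.Properties using (suc-injective; punchInᵢ≢i)
open import Data.Integer as ℤ using (ℤ; -[1+_])
import Data.Integer.Properties as ℤP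
open import Data.Rational as ℚ using (ℚ; 0ℚ; 1ℚ; ½; _+_; _*_; -_; _-_; toℚᵘ)
import Data.Rational.Properties as ℚP
open import Data.Rational.Unnormalised as ℚᵘ using (mkℚᵘ; *≡*)
import Data.Rational.Unnormalised.Properties as ℚᵘP
open import Algebra.Bundles using (CommutativeRing)
open import Algebra.Properties.Semiring.Sum (CommutativeRing.semiring ℚP.+-*-commutativeRing)
  using (sum; sum-syntax; sum-cong-≗; sum-replicate-zero; ∑-distrib-+; ∑-comm; *-distribˡ-sum; sum-remove)
open import Algebra.Properties.Group ℚP.+-0-group using (inverseˡ-unique; \\-leftDividesʳ)
open import Data.List using (List; []; _∷_; _++_; length)
open import Data.List.Properties using (length-++)
open import Data.List.Membership.Propositional using (_∈_; _∉_)
open import Data.List.Relation.Unary.Any using (here; there)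
import Data.List.Relation.Unary.All as All
open import Data.List.Relation.Unary.All.Properties using (¬Any⇒All¬)
open import Data.List.Relation.Unary.AllPairs using ([]; _∷_)
open import Data.List.Relation.Unary.Unique.Propositional using (Unique)
import Data.Product as Product
open import Data.Product using (Σ; _×_; _,_; proj₁; proj₂)
open import Data.Sum using (_⊎_; inj₁; inj₂)
open import Data.Empty using (⊥-elim)
open import Function using (_∘_)
open import Relation.Nullary using (Dec; yes; no; ¬_)
open import Relation.Nullary.Decidable using (does; map′; dec-true; dec-false)
open import Relation.Binary.PropositionalEquality

IsInteger : ℚ → Set
IsInteger q = Σ ℤ λ z → toℚᵘ q ℚᵘ.≃ mkℚᵘ z 0

integer-ℕ : ∀ k → IsInteger (ℕ→ℚ k)
integer-ℕ k = ℤ.+ k , ℚP.toℚᵘ-fromℚᵘ (mkℚᵘ (ℤ.+ k) 0)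

integer-0 : IsInteger 0ℚ
integer-0 = integer-ℕ 0

integer-+ : ∀ {p q} → IsInteger p → IsInteger q → IsInteger (p + q)
integer-+ {p} {q} (a , p≃a) (b , q≃b) =
  a ℤ.+ b , ℚᵘP.≃-trans (ℚP.toℚᵘ-homo-+ p q) (ℚᵘP.≃-trans (ℚᵘP.+-cong p≃a q≃b)
    (*≡* (cong (ℤ._* ℤ.+ 1) (cong₂ ℤ._+_ (ℤP.*-identityʳ a) (ℤP.*-identityʳ b)))))

integer-* : ∀ {p q} → IsInteger p → IsInteger q → IsInteger (p * q)
integer-* {p} {q} (a , p≃a) (b , q≃b) =
  a ℤ.* b , ℚᵘP.≃-trans (ℚP.toℚᵘ-homo-* p q) (ℚᵘP.≃-trans (ℚᵘP.*-cong p≃a q≃b) (*≡* refl))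

integer-neg : ∀ {p} → IsInteger p → IsInteger (- p)
integer-neg {p} (a , p≃a) =
  ℤ.- a , ℚᵘP.≃-trans (ℚP.toℚᵘ-homo‿- p) (ℚᵘP.≃-trans (ℚᵘP.-‿cong p≃a) (*≡* refl))

integer-− : ∀ {p q} → IsInteger p → IsInteger q → IsInteger (p - q)
integer-− p q = integer-+ p (integer-neg q)

integer-sum : ∀ {m} (f : Fin m → ℚ) → (∀ i → IsInteger (f i)) → IsInteger (sum f)
integer-sum {zero}  f _   = integer-0
integer-sum {suc m} f ints = integer-+ (ints zero) (integer-sum (λ i → f (suc i)) (λ i → ints (suc i)))

-- ½ is not an integer: z/1 ≃ 1/2 would mean 2z = 1.
½-not-integer : ¬ IsInteger ½
½-not-integer (ℤ.+ 0 , *≡* ())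
½-not-integer (ℤ.+ suc n , *≡* eq) with ℤP.+-injective eq
... | ()
½-not-integer (-[1+ n ] , *≡* ())

integer-cancel-unit : ∀ {q u} → IsInteger u → u * u ≡ 1ℚ → IsInteger (q * u) → IsInteger q
integer-cancel-unit {q} {u} int-u u²≡1 int-qu = subst IsInteger q·u·u≡q (integer-* int-qu int-u)
  where
    q·u·u≡q : q * u * u ≡ q
    q·u·u≡q = begin
      q * u * u    ≡⟨ ℚP.*-assoc q u u ⟩
      q * (u * u)  ≡⟨ cong (q *_) u²≡1 ⟩
      q * 1ℚ       ≡⟨ ℚP.*-identityʳ q ⟩
      q            ∎
      where open ≡-Reasoning

Σℚ≡sum : ∀ {m} (f : Fin m → ℚ) → Σℚ f ≡ sum f
Σℚ≡sum {zero}  f = refl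
Σℚ≡sum {suc m} f = cong (f zero +_) (Σℚ≡sum (λ i → f (suc i)))

sum-neg : ∀ {m} (f : Fin m → ℚ) → ∑[ i < m ] (- f i) ≡ - sum f
sum-neg {zero}  f = refl
sum-neg {suc m} f = trans (cong (- f zero +_) (sum-neg (λ i → f (suc i))))
                          (sym (ℚP.neg-distrib-+ (f zero) (sum (λ i → f (suc i)))))

∑-distrib-− : ∀ {m} (f g : Fin m → ℚ) → ∑[ i < m ] (f i - g i) ≡ sum f - sum g
∑-distrib-− f g = trans (∑-distrib-+ f (λ i → - g i)) (cong (sum f +_) (sum-neg g))

_when_ : {P : Set} → ℚ → Dec P → ℚ
a when yes _ = a
a when no  _ = 0ℚ

when-map : ∀ {P Q : Set} (f : P → Q) (g : Q → P) a (d : Dec P) → a when map′ f g d ≡ a when d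
when-map f g a (yes _) = refl
when-map f g a (no  _) = refl

when-* : ∀ {P : Set} c a (d : Dec P) → (c * a) when d ≡ c * (a when d)
when-* c a (yes _) = refl
when-* c a (no  _) = sym (ℚP.*-zeroʳ c)

sum-δ : ∀ {n} (w : Fin n) (F : Fin n → ℚ) → ∑[ v < n ] (F v when (w ≟ v)) ≡ F w
sum-δ {suc n} zero    F = trans (cong (F zero +_) (sum-replicate-zero n)) (ℚP.+-identityʳ (F zero))
sum-δ {suc n} (suc w) F = trans (ℚP.+-identityˡ _)
  (trans (sum-cong-≗ (λ v → when-map (cong suc) suc-injective (F (suc v)) (w ≟ v))) (sum-δ w (λ v → F (suc v))))

isolate : ∀ {m} (D : Fin m → ℚ) (g₀ : Fin m) → sum D ≡ 0ℚ
        → (∀ g → g ≢ g₀ → IsInteger (D g)) → IsInteger (D g₀)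
isolate {suc m} D g₀ ΣD≡0 others = subst IsInteger (sym D₀≡-rest) (integer-neg int-rest)
  where
    rest : ℚ
    rest = ∑[ i < m ] D (punchIn g₀ i)
    int-rest : IsInteger rest
    int-rest = integer-sum _ (λ i → others _ (punchInᵢ≢i g₀ i))
    D₀≡-rest : D g₀ ≡ - rest
    D₀≡-rest = inverseˡ-unique (D g₀) rest (trans (sym (sum-remove {i = g₀} D)) ΣD≡0)

⟦_⟧ : Bool → ℚ
⟦ true  ⟧ = 1ℚ
⟦ false ⟧ = 0ℚ

jump : Bool → Bool → ℚ
jump a b = ⟦ a ⟧ - ⟦ b ⟧

jump-integer : ∀ a b → IsInteger (jump a b)
jump-integer a b = integer-− (indicator-integer a) (indicator-integer b)
  where
    indicator-integer : ∀ c → IsInteger ⟦ c ⟧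
    indicator-integer true  = integer-ℕ 1
    indicator-integer false = integer-0

jump-zero : ∀ {a b} → a ≡ b → jump a b ≡ 0ℚ
jump-zero {a} refl = ℚP.+-inverseʳ ⟦ a ⟧

jump-unit : ∀ {a b} → a ≢ b → jump a b * jump a b ≡ 1ℚ
jump-unit {true}  {false} _   = refl
jump-unit {false} {true}  _   = refl
jump-unit {true}  {true}  a≢b = ⊥-elim (a≢b refl)
jump-unit {false} {false} a≢b = ⊥-elim (a≢b refl)

module Flows {n m : ℕ} (G : Graph n m) where

  Balanced : (Fin m → ℚ) → Set
  Balanced x = ∀ v → ∑[ e < m ] (x e when (head G e ≟ v)) ≡ ∑[ e < m ] (x e when (tail G e ≟ v))

  regroup : (x : Fin m → ℚ) (φ : Fin n → ℚ) (ep : Fin m → Fin n)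
          → ∑[ g < m ] (x g * φ (ep g)) ≡ ∑[ v < n ] (φ v * ∑[ g < m ] (x g when (ep g ≟ v)))
  regroup x φ ep = begin
    ∑[ g < m ] (x g * φ (ep g))
      ≡⟨ sum-cong-≗ (λ g → trans (ℚP.*-comm (x g) (φ (ep g))) (sym (sum-δ (ep g) (λ v → φ v * x g)))) ⟩
    ∑[ g < m ] ∑[ v < n ] ((φ v * x g) when (ep g ≟ v))
      ≡⟨ ∑-comm (λ g v → (φ v * x g) when (ep g ≟ v)) ⟩
    ∑[ v < n ] ∑[ g < m ] ((φ v * x g) when (ep g ≟ v))
      ≡⟨ sum-cong-≗ (λ v → trans (sum-cong-≗ (λ g → when-* (φ v) (x g) (ep g ≟ v)))
                                 (sym (*-distribˡ-sum (φ v) (λ g → x g when (ep g ≟ v))))) ⟩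
    ∑[ v < n ] (φ v * ∑[ g < m ] (x g when (ep g ≟ v)))  ∎
    where open ≡-Reasoning

  -- A balanced flow has no net value across any potential difference:
  -- Σ_g x_g (φ(head g) − φ(tail g)) = Σ_v φ(v) (inflow(v) − outflow(v)) = 0.
  potential-balance : ∀ {x} → Balanced x → (φ : Fin n → ℚ)
                    → ∑[ g < m ] (x g * (φ (head G g) - φ (tail G g))) ≡ 0ℚ
  potential-balance {x} bal φ = begin
    ∑[ g < m ] (x g * (φ (head G g) - φ (tail G g)))
      ≡⟨ sum-cong-≗ (λ g → *-distribˡ-− (x g) (φ (head G g)) (φ (tail G g))) ⟩
    ∑[ g < m ] (x g * φ (head G g) - x g * φ (tail G g))
      ≡⟨ ∑-distrib-− (λ g → x g * φ (head G g)) (λ g → x g * φ (tail G g)) ⟩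
    ∑[ g < m ] (x g * φ (head G g)) - ∑[ g < m ] (x g * φ (tail G g))
      ≡⟨ cong₂ _-_ (regroup x φ (head G)) (regroup x φ (tail G)) ⟩
    inflowValue - outflowValue
      ≡⟨ cong (_- outflowValue) (sum-cong-≗ (λ v → cong (φ v *_) (bal v))) ⟩
    outflowValue - outflowValue
      ≡⟨ ℚP.+-inverseʳ outflowValue ⟩
    0ℚ ∎
    where
      open ≡-Reasoning
      inflowValue outflowValue : ℚ
      inflowValue  = ∑[ v < n ] (φ v * ∑[ g < m ] (x g when (head G g ≟ v)))
      outflowValue = ∑[ v < n ] (φ v * ∑[ g < m ] (x g when (tail G g ≟ v)))
      *-distribˡ-− : ∀ a b c → a * (b - c) ≡ a * b - a * c
      *-distribˡ-− a b c = trans (ℚP.*-distribˡ-+ a b (- c)) (cong (a * b +_) (sym (ℚP.neg-distribʳ-* a c)))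

  cut-integrality : ∀ {x} → Balanced x → (σ : Fin n → Bool) (g₀ : Fin m)
                  → σ (head G g₀) ≢ σ (tail G g₀)
                  → (∀ g → g ≢ g₀ → IsInteger (x g) ⊎ σ (head G g) ≡ σ (tail G g))
                  → IsInteger (x g₀)
  cut-integrality {x} bal σ g₀ g₀-crosses others =
    integer-cancel-unit (jump-integer (σ (head G g₀)) (σ (tail G g₀))) (jump-unit g₀-crosses)
      (isolate (λ g → x g * χ g) g₀ (potential-balance bal (λ v → ⟦ σ v ⟧)) term-integer)
    where
      χ : Fin m → ℚ
      χ g = jump (σ (head G g)) (σ (tail G g))
      term-integer : ∀ g → g ≢ g₀ → IsInteger (x g * χ g)
      term-integer g g≢g₀ with others g g≢g₀
      ... | inj₁ x-integer = integer-* x-integer (jump-integer (σ (head G g)) (σ (tail G g)))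
      ... | inj₂ same-side =
        subst IsInteger (sym (trans (cong (x g *_) (jump-zero same-side)) (ℚP.*-zeroʳ (x g)))) integer-0

xor-true : ∀ a b → a xor b ≡ true → a ≡ true ⊎ b ≡ true
xor-true true  _    _  = inj₁ refl
xor-true false true _  = inj₂ refl

xor-swap : ∀ a b c → a xor (b xor c) ≡ b xor (a xor c)
xor-swap a b c = trans (sym (xor-assoc a b c)) (trans (cong (_xor c) (xor-comm a b)) (xor-assoc b a c))

xor-sandwich : ∀ a b → b xor (a xor b) ≡ a
xor-sandwich a b = trans (xor-swap b a b) (trans (cong (a xor_) (xor-same b)) (xor-identityʳ a))

xor-cancelʳ : ∀ a b c → a xor c ≡ b xor c → a ≡ b
xor-cancelʳ a b c eq = begin
  a                ≡⟨ sym (xor-sandwich a c) ⟩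
  c xor (a xor c)  ≡⟨ cong (c xor_) eq ⟩
  c xor (b xor c)  ≡⟨ xor-sandwich b c ⟩
  b                ∎
  where open ≡-Reasoning

xor-true-flips : ∀ a → a ≢ a xor true
xor-true-flips true  ()
xor-true-flips false ()

module _ {k : ℕ} where

  open import Data.List.Membership.DecPropositional (_≟_ {n = k}) using (_∈?_)

  parity : Fin k → List (Fin k) → Bool
  parity e []       = false
  parity e (f ∷ fs) = does (e ≟ f) xor parity e fs

  parity-++ : ∀ e xs ys → parity e (xs ++ ys) ≡ parity e xs xor parity e ys
  parity-++ e []       ys = refl
  parity-++ e (f ∷ xs) ys = trans (cong (does (e ≟ f) xor_) (parity-++ e xs ys))
                                 (sym (xor-assoc (does (e ≟ f)) (parity e xs) (parity e ys)))

  parity-∉ : ∀ {e} xs → e ∉ xs → parity e xs ≡ false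
  parity-∉ []       _   = refl
  parity-∉ (f ∷ xs) e∉ = cong₂ _xor_ (dec-false (_ ≟ f) (e∉ ∘ here)) (parity-∉ xs (e∉ ∘ there))

  parity-cons : ∀ {e f fs} → f ∉ fs → (e ∈ fs → parity e fs ≡ true)
              → e ∈ f ∷ fs → parity e (f ∷ fs) ≡ true
  parity-cons {e} {f} {fs} f∉fs _ (here refl) = cong₂ _xor_ (dec-true (e ≟ e) refl) (parity-∉ fs f∉fs)
  parity-cons {e} {f} f∉fs odd (there e∈fs) =
    cong₂ _xor_ (dec-false (e ≟ f) (λ { refl → f∉fs e∈fs })) (odd e∈fs)

  data Repeats : List (Fin k) → Set where
    at-head : ∀ {x xs} → x ∈ xs → Repeats (x ∷ xs)
    in-tail : ∀ {x xs} → Repeats xs → Repeats (x ∷ xs)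

  repeats-or-unique : ∀ xs → Repeats xs ⊎ Unique xs
  repeats-or-unique []       = inj₂ []
  repeats-or-unique (x ∷ xs) with x ∈? xs | repeats-or-unique xs
  ... | yes x∈xs | _        = inj₁ (at-head x∈xs)
  ... | no  _    | inj₁ rep = inj₁ (in-tail rep)
  ... | no  x∉xs | inj₂ u   = inj₂ (¬Any⇒All¬ xs x∉xs ∷ u)

module Walks {n m : ℕ} (G : Graph n m) {S : Fin m → Set} where

  infixr 5 _++w_
  _++w_ : ∀ {u v w} → Walk G S u v → Walk G S v w → Walk G S u w
  []        ++w q = q
  fwd e s p ++w q = fwd e s (p ++w q)
  bwd e s p ++w q = bwd e s (p ++w q)

  ++w-assoc : ∀ {u v w z} (p : Walk G S u v) (q : Walk G S v w) (r : Walk G S w z)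
            → (p ++w q) ++w r ≡ p ++w q ++w r
  ++w-assoc []          q r = refl
  ++w-assoc (fwd e s p) q r = cong (fwd e s) (++w-assoc p q r)
  ++w-assoc (bwd e s p) q r = cong (bwd e s) (++w-assoc p q r)

  edges-++w : ∀ {u v w} (p : Walk G S u v) (q : Walk G S v w) → edges G (p ++w q) ≡ edges G p ++ edges G q
  edges-++w []          q = refl
  edges-++w (fwd e s p) q = cong (e ∷_) (edges-++w p q)
  edges-++w (bwd e s p) q = cong (e ∷_) (edges-++w p q)

  len : ∀ {u v} → Walk G S u v → ℕ
  len p = length (edges G p)

  par : ∀ {u v} → Fin m → Walk G S u v → Bool
  par e p = parity e (edges G p)

  len-++w : ∀ {u v w} (p : Walk G S u v) (q : Walk G S v w) → len (p ++w q) ≡ len p ℕ.+ len q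
  len-++w p q = trans (cong length (edges-++w p q)) (length-++ (edges G p))

  par-++w : ∀ e {u v w} (p : Walk G S u v) (q : Walk G S v w) → par e (p ++w q) ≡ par e p xor par e q
  par-++w e p q = trans (cong (parity e) (edges-++w p q)) (parity-++ e (edges G p) (edges G q))

  len-middle : ∀ {u v w t} (x : Walk G S u v) (y : Walk G S v w) (z : Walk G S w t)
             → len y ≤ len (x ++w y ++w z)
  len-middle x y z = subst (len y ≤_) (sym (trans (len-++w x (y ++w z)) (cong (len x ℕ.+_) (len-++w y z))))
    (ℕP.≤-trans (ℕP.m≤m+n (len y) (len z)) (ℕP.m≤n+m (len y ℕ.+ len z) (len x)))

  data Step (f : Fin m) : Fin n → Fin n → Set where
    forward  : S f → Step f (tail G f) (head G f)
    backward : S f → Step f (head G f) (tail G f)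

  ⟨_⟩ : ∀ {f a b} → Step f a b → Walk G S a b
  ⟨ forward  s ⟩ = fwd _ s []
  ⟨ backward s ⟩ = bwd _ s []

  edges-step : ∀ {f a b} (s : Step f a b) → edges G ⟨ s ⟩ ≡ f ∷ []
  edges-step (forward  _) = refl
  edges-step (backward _) = refl

  step-nonempty : ∀ {f a b c} (s : Step f a b) (r : Walk G S b c) → 0 < len (⟨ s ⟩ ++w r)
  step-nonempty (forward  _) r = s≤s z≤n
  step-nonempty (backward _) r = s≤s z≤n

  start-visited : ∀ {u w} (p : Walk G S u w) → u ∈ verts G p
  start-visited []          = here refl
  start-visited (fwd e s p) = here refl
  start-visited (bwd e s p) = here refl

  endpoints-visited : ∀ {u w e} (p : Walk G S u w) → e ∈ edges G p → tail G e ∈ verts G p × head G e ∈ verts G p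
  endpoints-visited (fwd e s p) (here refl) = here refl , there (start-visited p)
  endpoints-visited (bwd e s p) (here refl) = there (start-visited p) , here refl
  endpoints-visited (fwd f s p) (there e∈p) = Product.map there there (endpoints-visited p e∈p)
  endpoints-visited (bwd f s p) (there e∈p) = Product.map there there (endpoints-visited p e∈p)

  path-parity : ∀ {u w e} (p : Walk G S u w) → IsPath G p → e ∈ edges G p → par e p ≡ true
  path-parity (fwd f s p) (fresh ∷ path) =
    parity-cons (λ f∈p → All.lookup fresh (proj₁ (endpoints-visited p f∈p)) refl) (path-parity p path)
  path-parity (bwd f s p) (fresh ∷ path) =
    parity-cons (λ f∈p → All.lookup fresh (proj₂ (endpoints-visited p f∈p)) refl) (path-parity p path)

  record Decomposition {v} (c : Walk G S v v) : Set where
    field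
      v₁ v₂      : Fin n
      c₁         : Walk G S v₁ v₁
      c₂         : Walk G S v₂ v₂
      c₁-shorter : len c₁ < len c
      c₂-shorter : len c₂ < len c
      par-split  : ∀ e → par e c ≡ par e c₁ xor par e c₂

  splice : ∀ {v a b} (x : Walk G S v a) (y : Walk G S a a) (z : Walk G S a v) (y′ : Walk G S b b)
         → 0 < len y → len y′ < len (x ++w y ++w z) → (∀ e → par e y′ ≡ par e y)
         → Decomposition (x ++w y ++w z)
  splice {v} {a} {b} x y z y′ y-nonempty y′-shorter same-par =
    record { v₁ = b ; v₂ = v ; c₁ = y′ ; c₂ = x ++w z ; c₁-shorter = y′-shorter
           ; c₂-shorter = rest-shorter ; par-split = split }
    where
      rest-shorter : len (x ++w z) < len (x ++w y ++w z)
      rest-shorter = subst₂ _<_ (sym (len-++w x z))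
        (sym (trans (len-++w x (y ++w z)) (cong (len x ℕ.+_) (len-++w y z))))
        (ℕP.+-monoʳ-< (len x) (ℕP.m<n+m (len z) y-nonempty))
      split : ∀ e → par e (x ++w y ++w z) ≡ par e y′ xor par e (x ++w z)
      split e = begin
        par e (x ++w y ++w z)
          ≡⟨ trans (par-++w e x (y ++w z)) (cong (par e x xor_) (par-++w e y z)) ⟩
        par e x xor (par e y xor par e z)     ≡⟨ xor-swap (par e x) (par e y) (par e z) ⟩
        par e y xor (par e x xor par e z)     ≡⟨ cong₂ _xor_ (sym (same-par e)) (sym (par-++w e x z)) ⟩
        par e y′ xor par e (x ++w z)          ∎
        where open ≡-Reasoning

  cut-loop : ∀ {v a} (x : Walk G S v a) (y : Walk G S a a) (z : Walk G S a v)
           → 0 < len y → 0 < len z → Decomposition (x ++w y ++w z)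
  cut-loop x y z y-nonempty z-nonempty = splice x y z y y-nonempty y-shorter (λ _ → refl)
    where
      y-shorter : len y < len (x ++w y ++w z)
      y-shorter = ℕP.<-≤-trans (subst (len y <_) (sym (len-++w y z)) (ℕP.m<m+n (len y) z-nonempty))
                              (subst (len (y ++w z) ≤_) (sym (len-++w x (y ++w z))) (ℕP.m≤n+m _ (len x)))

  record Detour {u w} (p : Walk G S u w) : Set where
    constructor detour
    field
      {a}            : Fin n
      before         : Walk G S u a
      loop           : Walk G S a a
      after          : Walk G S a w
      split          : p ≡ before ++w loop ++w after
      loop-nonempty  : 0 < len loop
      after-nonempty : 0 < len after

  split-at-vertex : ∀ {u w a} (p : Walk G S u w) → a ∈ initVerts G p
                  → Σ (Walk G S u a) λ p₁ → Σ (Walk G S a w) λ p₂ → p ≡ p₁ ++w p₂ × 0 < len p₂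
  split-at-vertex (fwd e s p) (here refl) = [] , fwd e s p , refl , s≤s z≤n
  split-at-vertex (bwd e s p) (here refl) = [] , bwd e s p , refl , s≤s z≤n
  split-at-vertex (fwd e s p) (there a∈p) with split-at-vertex p a∈p
  ... | p₁ , p₂ , refl , p₂-nonempty = fwd e s p₁ , p₂ , refl , p₂-nonempty
  split-at-vertex (bwd e s p) (there a∈p) with split-at-vertex p a∈p
  ... | p₁ , p₂ , refl , p₂-nonempty = bwd e s p₁ , p₂ , refl , p₂-nonempty

  repeated-vertex⇒detour : ∀ {u w} (p : Walk G S u w) → Repeats (initVerts G p) → Detour p
  repeated-vertex⇒detour (fwd e s p) (at-head u∈p) with split-at-vertex p u∈p
  ... | p₁ , p₂ , refl , p₂-nonempty = detour [] (fwd e s p₁) p₂ refl (s≤s z≤n) p₂-nonempty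
  repeated-vertex⇒detour (bwd e s p) (at-head u∈p) with split-at-vertex p u∈p
  ... | p₁ , p₂ , refl , p₂-nonempty = detour [] (bwd e s p₁) p₂ refl (s≤s z≤n) p₂-nonempty
  repeated-vertex⇒detour (fwd e s p) (in-tail rep) with repeated-vertex⇒detour p rep
  ... | detour x y z refl y-ne z-ne = detour (fwd e s x) y z refl y-ne z-ne
  repeated-vertex⇒detour (bwd e s p) (in-tail rep) with repeated-vertex⇒detour p rep
  ... | detour x y z refl y-ne z-ne = detour (bwd e s x) y z refl y-ne z-ne

  detour⇒decomposition : ∀ {v} {c : Walk G S v v} → Detour c → Decomposition c
  detour⇒decomposition (detour x y z refl y-nonempty z-nonempty) = cut-loop x y z y-nonempty z-nonempty

  record EdgeSplit {u w} (p : Walk G S u w) (f : Fin m) : Set where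
    constructor edge-split
    field
      {a b}  : Fin n
      before : Walk G S u a
      step   : Step f a b
      after  : Walk G S b w
      split  : p ≡ before ++w ⟨ step ⟩ ++w after

  split-at-edge : ∀ {u w f} (p : Walk G S u w) → f ∈ edges G p → EdgeSplit p f
  split-at-edge (fwd f s p) (here refl) = edge-split [] (forward s) p refl
  split-at-edge (bwd f s p) (here refl) = edge-split [] (backward s) p refl
  split-at-edge (fwd e s p) (there f∈p) with split-at-edge p f∈p
  ... | edge-split x st z refl = edge-split (fwd e s x) st z refl
  split-at-edge (bwd e s p) (there f∈p) with split-at-edge p f∈p
  ... | edge-split x st z refl = edge-split (bwd e s x) st z refl

  record DoubleTraversal {u w} (p : Walk G S u w) : Set where
    constructor double-traversal
    field
      {f}          : Fin m
      {a b a′ b′}  : Fin n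
      before       : Walk G S u a
      first        : Step f a b
      middle       : Walk G S b a′
      second       : Step f a′ b′
      after        : Walk G S b′ w
      split        : p ≡ before ++w ⟨ first ⟩ ++w middle ++w ⟨ second ⟩ ++w after

  repeated-edge⇒double-traversal : ∀ {u w} (p : Walk G S u w) → Repeats (edges G p) → DoubleTraversal p
  repeated-edge⇒double-traversal (fwd f s p) (at-head f∈p) with split-at-edge p f∈p
  ... | edge-split r st z refl = double-traversal [] (forward s) r st z refl
  repeated-edge⇒double-traversal (bwd f s p) (at-head f∈p) with split-at-edge p f∈p
  ... | edge-split r st z refl = double-traversal [] (backward s) r st z refl
  repeated-edge⇒double-traversal (fwd e s p) (in-tail rep) with repeated-edge⇒double-traversal p rep
  ... | double-traversal x s₁ r s₂ z refl = double-traversal (fwd e s x) s₁ r s₂ z refl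
  repeated-edge⇒double-traversal (bwd e s p) (in-tail rep) with repeated-edge⇒double-traversal p rep
  ... | double-traversal x s₁ r s₂ z refl = double-traversal (bwd e s x) s₁ r s₂ z refl

  -- Both traversals in the same direction: ⟨s⟩ ++ r is a loop.
  same-direction : ∀ {v a b f} (x : Walk G S v a) (s : Step f a b) (r : Walk G S b a)
                   (s′ : Step f a b) (z : Walk G S b v)
                 → Decomposition (x ++w ⟨ s ⟩ ++w r ++w ⟨ s′ ⟩ ++w z)
  same-direction x s r s′ z =
    subst Decomposition (cong (x ++w_) (++w-assoc ⟨ s ⟩ r (⟨ s′ ⟩ ++w z)))
      (cut-loop x (⟨ s ⟩ ++w r) (⟨ s′ ⟩ ++w z) (step-nonempty s r) (step-nonempty s′ z))

  -- Opposite directions: the two traversals cancel mod 2, leaving the loop r.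
  opposite-direction : ∀ {v a b f} (x : Walk G S v a) (s : Step f a b) (r : Walk G S b b)
                       (s′ : Step f b a) (z : Walk G S a v)
                     → Decomposition (x ++w ⟨ s ⟩ ++w r ++w ⟨ s′ ⟩ ++w z)
  opposite-direction {a = a} {f = f} x s r s′ z =
    subst Decomposition (cong (x ++w_) reassociate)
      (splice x y z r (step-nonempty s (r ++w ⟨ s′ ⟩)) (ℕP.<-≤-trans r-shorter (len-middle x y z)) same-par)
    where
      y : Walk G S a a
      y = ⟨ s ⟩ ++w r ++w ⟨ s′ ⟩
      reassociate : y ++w z ≡ ⟨ s ⟩ ++w r ++w ⟨ s′ ⟩ ++w z
      reassociate = trans (++w-assoc ⟨ s ⟩ (r ++w ⟨ s′ ⟩) z) (cong (⟨ s ⟩ ++w_) (++w-assoc r ⟨ s′ ⟩ z))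
      r-shorter : len r < len y
      r-shorter = subst (len r <_)
        (sym (trans (len-++w ⟨ s ⟩ (r ++w ⟨ s′ ⟩)) (cong₂ ℕ._+_ (cong length (edges-step s)) (len-++w r ⟨ s′ ⟩))))
        (s≤s (ℕP.m≤m+n (len r) (len ⟨ s′ ⟩)))
      same-par : ∀ e → par e r ≡ par e y
      same-par e = sym (begin
        par e y
          ≡⟨ trans (par-++w e ⟨ s ⟩ (r ++w ⟨ s′ ⟩)) (cong (par e ⟨ s ⟩ xor_) (par-++w e r ⟨ s′ ⟩)) ⟩
        par e ⟨ s ⟩ xor (par e r xor par e ⟨ s′ ⟩)
          ≡⟨ cong₂ (λ p q → p xor (par e r xor q)) (cong (parity e) (edges-step s)) (cong (parity e) (edges-step s′)) ⟩
        parity e (f ∷ []) xor (par e r xor parity e (f ∷ []))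
          ≡⟨ xor-sandwich (par e r) (parity e (f ∷ [])) ⟩
        par e r ∎)
        where open ≡-Reasoning

  double-traversal⇒decomposition : ∀ {v} {c : Walk G S v v} → DoubleTraversal c → Decomposition c
  double-traversal⇒decomposition (double-traversal x s@(forward _)  r s′@(forward _)  z refl) =
    same-direction x s r s′ z
  double-traversal⇒decomposition (double-traversal x s@(backward _) r s′@(backward _) z refl) =
    same-direction x s r s′ z
  double-traversal⇒decomposition (double-traversal x s@(forward _)  r s′@(backward _) z refl) =
    opposite-direction x s r s′ z
  double-traversal⇒decomposition (double-traversal x s@(backward _) r s′@(forward _)  z refl) =
    opposite-direction x s r s′ z

  cycle-or-decomposition : ∀ {v} (c : Walk G S v v) → edges G c ≢ [] → IsCycle G c ⊎ Decomposition c
  cycle-or-decomposition c nonempty with repeats-or-unique (initVerts G c) | repeats-or-unique (edges G c)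
  ... | inj₁ rep-v | _         = inj₂ (detour⇒decomposition (repeated-vertex⇒detour c rep-v))
  ... | inj₂ _     | inj₁ rep-e =
    inj₂ (double-traversal⇒decomposition (repeated-edge⇒double-traversal c rep-e))
  ... | inj₂ uniq-v | inj₂ uniq-e = inj₁ (nonempty , uniq-e , uniq-v)

  Cycle : Set
  Cycle = Σ (Fin n) λ v → Σ (Walk G S v v) (IsCycle G)

  odd⇒nonempty : ∀ e {u w} (p : Walk G S u w) → par e p ≡ true → edges G p ≢ []
  odd⇒nonempty e p odd no-edges with trans (sym (cong (parity e) no-edges)) odd
  ... | ()

  -- A closed walk traversing some edge an odd number of times contains a
  -- cycle: decompose until a cycle appears, always keeping an odd part.
  odd⇒cycle : ∀ e {v} (c : Walk G S v v) → par e c ≡ true → Cycle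
  odd⇒cycle e c odd = search (suc (len c)) c (ℕP.n<1+n (len c)) odd
    where
      open Decomposition
      search : ∀ k {v} (c : Walk G S v v) → len c < k → par e c ≡ true → Cycle
      search (suc k) c (s≤s c≤k) odd with cycle-or-decomposition c (odd⇒nonempty e c odd)
      ... | inj₁ is-cycle = _ , c , is-cycle
      ... | inj₂ d with xor-true (par e (c₁ d)) (par e (c₂ d)) (trans (sym (par-split d e)) odd)
      ...   | inj₁ odd₁ = search k (c₁ d) (ℕP.<-≤-trans (c₁-shorter d) c≤k) odd₁
      ...   | inj₂ odd₂ = search k (c₂ d) (ℕP.<-≤-trans (c₂-shorter d) c≤k) odd₂

module SpanningTree {n m : ℕ} (G : Graph n m) {S : Fin m → Set} (tree : IsSpanningTree G S) where

  open Walks G {S}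

  connect : ∀ u w → Walk G S u w
  connect = proj₁ tree

  closed-even : ∀ e {v} (c : Walk G S v v) → par e c ≡ false
  closed-even e c with par e c in odd
  ... | false = refl
  ... | true  = ⊥-elim (let v , c′ , is-cycle = odd⇒cycle e c odd in proj₂ tree v c′ is-cycle)

  par-path-independent : ∀ e {u w} (p q : Walk G S u w) → par e p ≡ par e q
  par-path-independent e {u} {w} p q = xor-cancelʳ (par e p) (par e q) (par e back) (begin
    par e p xor par e back  ≡⟨ sym (par-++w e p back) ⟩
    par e (p ++w back)      ≡⟨ closed-even e (p ++w back) ⟩
    false                   ≡⟨ sym (closed-even e (q ++w back)) ⟩
    par e (q ++w back)      ≡⟨ par-++w e q back ⟩
    par e q xor par e back  ∎)
    where
      open ≡-Reasoning
      back : Walk G S w u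
      back = connect w u

  side : (r : Fin n) (f : Fin m) → Fin n → Bool
  side r f v = par f (connect r v)

  side-along : ∀ r f {u w} (p : Walk G S u w) → side r f w ≡ side r f u xor par f p
  side-along r f {u} {w} p =
    trans (par-path-independent f (connect r w) (connect r u ++w p)) (par-++w f (connect r u) p)

  tree-edge-same-side : ∀ r f g → S g → g ≢ f → side r f (head G g) ≡ side r f (tail G g)
  tree-edge-same-side r f g s g≢f = begin
    side r f (head G g)                                    ≡⟨ side-along r f (fwd g s []) ⟩
    side r f (tail G g) xor (does (f ≟ g) xor false)
      ≡⟨ cong (λ b → side r f (tail G g) xor (b xor false)) (dec-false (f ≟ g) (g≢f ∘ sym)) ⟩
    side r f (tail G g) xor false                          ≡⟨ xor-identityʳ _ ⟩
    side r f (tail G g)                                    ∎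
    where open ≡-Reasoning

  tree-edge-crosses : ∀ r f → S f → side r f (head G f) ≢ side r f (tail G f)
  tree-edge-crosses r f s same =
    xor-true-flips (side r f (tail G f))
      (trans (sym same) (trans (side-along r f (fwd f s [])) (cong (side r f (tail G f) xor_) f-once)))
    where
      f-once : par f (fwd f s []) ≡ true
      f-once = parity-cons {e = f} {fs = []} (λ ()) (λ ()) (here refl)

  path-crosses : ∀ r f {u w} (p : Walk G S u w) → IsPath G p → f ∈ edges G p → side r f u ≢ side r f w
  path-crosses r f p path f∈p same =
    xor-true-flips (side r f _)
      (trans same (trans (side-along r f p) (cong (side r f _ xor_) (path-parity p path f∈p))))

module BasicSolution {n m : ℕ} (I : Instance n m) (BS : BasisStructure I) (x : Fin m → ℚ)
                     (basic : IsBasicSolution I BS x) where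

  G : Graph n m
  G = graph I

  ē : Fin m
  ē = ebar BS

  open Flows G
  open Walks G {InT BS}
  open SpanningTree G (tree BS)

  -- IsBasicSolution states conservation with locally defined inflow and
  -- outflow terms; these projections name them.
  Conservation : (Fin m → Fin n → ℚ) → (Fin m → Fin n → ℚ) → Set
  Conservation F H = ∀ v → Σℚ (λ e → F e v) ≡ Σℚ (λ e → H e v)

  inflow-term outflow-term : ∀ {F H} {R : Set} → Conservation F H × R → Fin m → Fin n → ℚ
  inflow-term  {F = F} _ = F
  outflow-term {H = H} _ = H

  inflow≡ : ∀ e v → inflow-term basic e v ≡ x e when (head G e ≟ v)
  inflow≡ e v with head G e ≟ v
  ... | yes _ = refl
  ... | no  _ = refl

  outflow≡ : ∀ e v → outflow-term basic e v ≡ x e when (tail G e ≟ v)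
  outflow≡ e v with tail G e ≟ v
  ... | yes _ = refl
  ... | no  _ = refl

  balanced : Balanced x
  balanced v = begin
    ∑[ e < m ] (x e when (head G e ≟ v))  ≡⟨ sum-cong-≗ (λ e → sym (inflow≡ e v)) ⟩
    sum (λ e → inflow-term basic e v)     ≡⟨ sym (Σℚ≡sum (λ e → inflow-term basic e v)) ⟩
    Σℚ (λ e → inflow-term basic e v)      ≡⟨ proj₁ basic v ⟩
    Σℚ (λ e → outflow-term basic e v)     ≡⟨ Σℚ≡sum (λ e → outflow-term basic e v) ⟩
    sum (λ e → outflow-term basic e v)    ≡⟨ sum-cong-≗ (λ e → outflow≡ e v) ⟩
    ∑[ e < m ] (x e when (tail G e ≟ v))  ∎
    where open ≡-Reasoning

  edge-kinds : ∀ g → g ≡ ē ⊎ IsInteger (x g) ⊎ cls BS g ≡ kT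
  edge-kinds g with cls BS g in kind
  ... | kL   = inj₂ (inj₁ (subst IsInteger (sym (proj₁ (proj₂ basic) g kind)) integer-0))
  ... | kU   = inj₂ (inj₁ (subst IsInteger (sym (proj₁ (proj₂ (proj₂ basic)) g kind)) (integer-ℕ (u I g))))
  ... | kBar = inj₁ (cls-bar-unique BS g kind)
  ... | kT   = inj₂ (inj₂ refl)

  r : Fin n
  r = head G ē

  -- An integral edge f on the tree path of C(ē) forces x ē to be integral:
  -- in the cut of T at f, only f and ē cross.
  cycle-edge⇒ē-integer : (P : CyclePath BS) → ∀ {f} → f ∈ edges G (proj₁ P)
                       → IsInteger (x f) → IsInteger (x ē)
  cycle-edge⇒ē-integer (p , path) {f} f∈p f-integer =
    cut-integrality balanced (side r f) ē (path-crosses r f p path f∈p) others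
    where
      others : ∀ g → g ≢ ē → IsInteger (x g) ⊎ side r f (head G g) ≡ side r f (tail G g)
      others g g≢ē with edge-kinds g
      ... | inj₁ g≡ē              = ⊥-elim (g≢ē g≡ē)
      ... | inj₂ (inj₁ g-integer) = inj₁ g-integer
      ... | inj₂ (inj₂ g∈T) with g ≟ f
      ...   | yes refl = inj₁ f-integer
      ...   | no  g≢f  = inj₂ (tree-edge-same-side r f g g∈T g≢f)

  cycle-integer⇒ē-integer : (P : CyclePath BS) → ∀ {e} → OnCycle BS P e
                          → IsInteger (x e) → IsInteger (x ē)
  cycle-integer⇒ē-integer P (inj₁ refl) e-integer = e-integer
  cycle-integer⇒ē-integer P (inj₂ e∈p)  e-integer = cycle-edge⇒ē-integer P e∈p e-integer

  -- Once x ē is integral, so is every x g: a tree edge g is the only edge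
  -- of T crossing its own cut.
  ē-integer⇒all : IsInteger (x ē) → ∀ g → IsInteger (x g)
  ē-integer⇒all ē-integer g with edge-kinds g
  ... | inj₁ refl             = ē-integer
  ... | inj₂ (inj₁ g-integer) = g-integer
  ... | inj₂ (inj₂ g∈T)       = cut-integrality balanced (side r g) g (tree-edge-crosses r g g∈T) others
    where
      others : ∀ g′ → g′ ≢ g → IsInteger (x g′) ⊎ side r g (head G g′) ≡ side r g (tail G g′)
      others g′ g′≢g with edge-kinds g′
      ... | inj₁ refl              = inj₁ ē-integer
      ... | inj₂ (inj₁ g′-integer) = inj₁ g′-integer
      ... | inj₂ (inj₂ g′∈T)       = inj₂ (tree-edge-same-side r g g′ g′∈T g′≢g)

  not-all-integer : ¬ (∀ g → IsInteger (x g))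
  not-all-integer all-integer =
    ½-not-integer (subst IsInteger (\\-leftDividesʳ (ℕ→ℚ (B I)) ½)
                                   (integer-+ (integer-neg (integer-ℕ (B I))) budget-integer))
    where
      fee : Fin m → ℚ
      fee g = ℕ→ℚ (b I g) * x g
      budget-integer : IsInteger (ℕ→ℚ (B I) + ½)
      budget-integer = subst IsInteger (trans (sym (Σℚ≡sum fee)) (proj₂ (proj₂ (proj₂ basic))))
        (integer-sum fee (λ g → integer-* (integer-ℕ (b I g)) (all-integer g)))

lemma3 : ∀ {n m : ℕ} (I : Instance n m) (BS : BasisStructure I) (x : Fin m → ℚ)
         → IsBasicSolution I BS x → IsFeasibleFlow I x
         → (P : CyclePath BS) → ∀ (e : Fin m) → OnCycle BS P e
         → ∀ (k : ℕ) → x e ≢ ℕ→ℚ k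
lemma3 I BS x basic _ P e on-cycle k x≡k =
  not-all-integer (ē-integer⇒all (cycle-integer⇒ē-integer P on-cycle e-integer))
  where
    open BasicSolution I BS x basic
    e-integer : IsInteger (x e)
    e-integer = subst IsInteger (sym x≡k) (integer-ℕ k)
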